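{- Let $\Gamma$ be a finite simple graph. Then $\Gamma$ has at least two isomorphic connected components if and only if the group $\mathcal{H}^0(\Gamma)$ is nontrivial.
   Context: For a finite simple graph $\Gamma$, $H^0(\Gamma)$ is the space of real-valued vertex functions $f$ with $f(w)-f(v)=0$ for every edge $(v,w)$. Each $g\in\mathrm{Aut}(\Gamma)$ acts on $H^0(\Gamma)$ by pullback $g^*f(v)=f(g(v))$. The homomorphism $\phi^0_\Gamma:\mathrm{Aut}(\Gamma)\to GL(H^0(\Gamma))$ is $\phi^0_\Gamma(g)=(g^*)^{ -1}$, and $\mathcal{H}^0(\Gamma)$ denotes its image (a group of linear operators on $H^0(\Gamma)$).
   Formalization: The vertex functions forming $H^0(\Gamma)$ take values in ℚ instead of the reals. -}

module Defs where

open import Data.Nat using (ℕ)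
open import Data.Fin using (Fin)
open import Data.Bool using (Bool; true; false)
open import Data.Rational using (ℚ)
open import Data.Product using (Σ; _×_)
open import Relation.Nullary using (¬_)
open import Relation.Binary.PropositionalEquality using (_≡_)
open import Data.Fin.Permutation using (Permutation′; _⟨$⟩ʳ_; _⟨$⟩ˡ_)

record SimpleGraph (n : ℕ) : Set where
  field
    adj    : Fin n → Fin n → Bool
    sym    : ∀ u v → adj u v ≡ adj v u
    irrefl : ∀ v → adj v v ≡ false
open SimpleGraph public

data Connected {n : ℕ} (Γ : SimpleGraph n) : Fin n → Fin n → Set where
  here : ∀ {u} → Connected Γ u u
  step : ∀ {u v w} → adj Γ u v ≡ true → Connected Γ v w → Connected Γ u w

record Aut {n : ℕ} (Γ : SimpleGraph n) : Set where
  field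
    perm     : Permutation′ n
    preserve : ∀ u v → adj Γ (perm ⟨$⟩ʳ u) (perm ⟨$⟩ʳ v) ≡ adj Γ u v
open Aut public

-- The connected component of u is isomorphic (as an induced subgraph)
-- to the connected component of v.
record ComponentIso {n : ℕ} (Γ : SimpleGraph n) (u v : Fin n) : Set where
  field
    to       : Fin n → Fin n
    from     : Fin n → Fin n
    to-mem   : ∀ w → Connected Γ u w → Connected Γ v (to w)
    from-mem : ∀ w → Connected Γ v w → Connected Γ u (from w)
    from-to  : ∀ w → Connected Γ u w → from (to w) ≡ w
    to-from  : ∀ w → Connected Γ v w → to (from w) ≡ w
    to-adj   : ∀ w w′ → Connected Γ u w → Connected Γ u w′ →
               adj Γ (to w) (to w′) ≡ adj Γ w w′

TwoIsoComponents : {n : ℕ} → SimpleGraph n → Set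
TwoIsoComponents {n} Γ =
  Σ (Fin n) λ u → Σ (Fin n) λ v → ¬ Connected Γ u v × ComponentIso Γ u v

IsH0 : {n : ℕ} → SimpleGraph n → (Fin n → ℚ) → Set
IsH0 {n} Γ f = ∀ v w → adj Γ v w ≡ true → f w ≡ f v

-- Pullback g* f = f ∘ g, and φ⁰(g) = (g*)⁻¹ = (g⁻¹)*, i.e. f ↦ f ∘ g⁻¹.
pullback : {n : ℕ} {Γ : SimpleGraph n} → Aut Γ → (Fin n → ℚ) → Fin n → ℚ
pullback g f v = f (perm g ⟨$⟩ʳ v)

phi0 : {n : ℕ} {Γ : SimpleGraph n} → Aut Γ → (Fin n → ℚ) → Fin n → ℚ
phi0 g f v = f (perm g ⟨$⟩ˡ v)

Phi0IsId : {n : ℕ} {Γ : SimpleGraph n} → Aut Γ → Set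
Phi0IsId {n} {Γ} g = ∀ (f : Fin n → ℚ) → IsH0 Γ f → ∀ v → phi0 g f v ≡ f v

-- The image group 𝓗⁰(Γ) = φ⁰(Aut Γ) is nontrivial: it contains an
-- element different from the identity operator.
H0GroupNontrivial : {n : ℕ} → SimpleGraph n → Set
H0GroupNontrivial Γ = Σ (Aut Γ) λ g → ¬ Phi0IsId g

module Submission where

open import Defs hiding (sym)
open import Data.Nat using (ℕ; zero; suc; z≤n; _≤′_; ≤′-refl; ≤′-step)
open import Data.Nat.Properties using (≤⇒≤′; n<1+n)
open import Data.Product using (_×_; _,_; ∃; proj₁)
open import Data.Sum using (_⊎_; inj₁; inj₂)
open import Data.Fin using (Fin; toℕ)
import Data.Fin.Properties as Fin
open import Data.Bool using (true; false)
import Data.Bool.Properties as Bool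
open import Data.Empty using (⊥; ⊥-elim)
open import Function using (_∘_)
open import Relation.Nullary using (¬_; Dec; yes; no; ¬?)
open import Relation.Nullary.Decidable using (map′; decidable-stable; _⊎-dec_; _×-dec_)
open import Relation.Binary.PropositionalEquality
open import Data.Fin.Permutation using (Permutation′; _⟨$⟩ʳ_; _⟨$⟩ˡ_; permutation; inverseˡ; inverseʳ)
open import Data.Rational using (ℚ; 0ℚ; 1ℚ)
open import Data.Rational.Properties using (1≢0)

-- H⁰(Γ) consists of the functions that are constant on each
-- connected component, so φ⁰(g) is the identity exactly when g maps every
-- vertex into its own component; indicator functions of components detect
-- any failure of this. If g moves a vertex v out of its component, g
-- restricts to an isomorphism between two distinct components. Conversely,
-- swapping two disjoint isomorphic components is an automorphism that
-- moves a vertex out of its component. The case distinctions are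
-- constructive because connectivity is decidable: the balls around a vertex
-- form an increasing chain of subsets of the vertex set, which stabilises.

module _ {n : ℕ} (P : ℕ → Fin n → Set) where

  StableAt : ℕ → Set
  StableAt k = ∀ w → P (suc k) w → P k w

  Grows : ℕ → Set
  Grows k = ∃ λ w → P (suc k) w × ¬ P k w

  module _ (P-step : ∀ {k w} → P k w → P (suc k) w) where

    chain-mono : ∀ {k m w} → k ≤′ m → P k w → P m w
    chain-mono ≤′-refl       p = p
    chain-mono (≤′-step k≤m) p = P-step (chain-mono k≤m p)

  module _ (P? : ∀ k w → Dec (P k w)) where

    ¬grows⇒stableAt : ∀ {k} → ¬ Grows k → StableAt k
    ¬grows⇒stableAt {k} ¬grows w p with P? k w
    ... | yes pk = pk
    ... | no ¬pk = ⊥-elim (¬grows (w , p , ¬pk))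

    grows? : ∀ k → Dec (Grows k)
    grows? k = Fin.any? (λ w → P? (suc k) w ×-dec ¬? (P? k w))

  module _ (P? : ∀ k w → Dec (P k w)) (P-step : ∀ {k w} → P k w → P (suc k) w) where

    -- The new elements of n + 1 successive growth steps would be n + 1
    -- distinct elements of Fin n.
    ¬grows-n+1-times : ¬ (∀ (i : Fin (suc n)) → Grows (toℕ i))
    ¬grows-n+1-times grows
      with i , j , i<j , same ← Fin.pigeonhole (n<1+n n) (λ i → proj₁ (grows i))
      with _ , new , _ ← grows i | _ , _ , old ← grows j
      = old (subst (P (toℕ j)) same (chain-mono P-step (≤⇒≤′ i<j) new))

    chain-stabilises : ∃ StableAt
    chain-stabilises with Fin.any? (λ (i : Fin (suc n)) → ¬? (grows? P? (toℕ i)))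
    ... | yes (i , ¬grows) = toℕ i , ¬grows⇒stableAt P? ¬grows
    ... | no none = ⊥-elim (¬grows-n+1-times λ i →
            decidable-stable (grows? P? (toℕ i)) (λ ¬grows → none (i , ¬grows)))

module _ {n : ℕ} (Γ : SimpleGraph n) where

  private
    _~_ : Fin n → Fin n → Set
    _~_ = Connected Γ

  connected-snoc : ∀ {u v w} → u ~ v → adj Γ v w ≡ true → u ~ w
  connected-snoc here       e = step e here
  connected-snoc (step d p) e = step d (connected-snoc p e)

  connected-sym : ∀ {u w} → u ~ w → w ~ u
  connected-sym here               = here
  connected-sym (step {u} {v} e p) =
    connected-snoc (connected-sym p) (trans (SimpleGraph.sym Γ v u) e)

  connected-trans : ∀ {u v w} → u ~ v → v ~ w → u ~ w
  connected-trans here       q = q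
  connected-trans (step e p) q = step e (connected-trans p q)

  adj-false : ∀ {v w} → ¬ v ~ w → adj Γ v w ≡ false
  adj-false {v} {w} v≁w with adj Γ v w in e
  ... | true  = ⊥-elim (v≁w (step e here))
  ... | false = refl

  Ball : ℕ → Fin n → Fin n → Set
  Ball zero    u w = u ≡ w
  Ball (suc k) u w = Ball k u w ⊎ ∃ λ x → Ball k u x × adj Γ x w ≡ true

  ball? : ∀ k u w → Dec (Ball k u w)
  ball? zero    u w = u Fin.≟ w
  ball? (suc k) u w =
    ball? k u w ⊎-dec Fin.any? (λ x → ball? k u x ×-dec (adj Γ x w Bool.≟ true))

  ball⇒connected : ∀ k {u w} → Ball k u w → u ~ w
  ball⇒connected zero    refl               = here
  ball⇒connected (suc k) (inj₁ b)           = ball⇒connected k b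
  ball⇒connected (suc k) (inj₂ (_ , b , e)) = connected-snoc (ball⇒connected k b) e

  ball-cons : ∀ k {u v w} → adj Γ u v ≡ true → Ball k v w → Ball (suc k) u w
  ball-cons zero    e refl                = inj₂ (_ , refl , e)
  ball-cons (suc k) e (inj₁ b)            = inj₁ (ball-cons k e b)
  ball-cons (suc k) e (inj₂ (x , b , e′)) = inj₂ (x , ball-cons k e b , e′)

  connected⇒ball : ∀ {u w} → u ~ w → ∃ λ k → Ball k u w
  connected⇒ball here = zero , refl
  connected⇒ball (step e p) with k , b ← connected⇒ball p = suc k , ball-cons k e b

  ball-stable : ∀ {k u} → StableAt (λ j → Ball j u) k → ∀ m {w} → Ball m u w → Ball k u w
  ball-stable {u = u} stable zero b   = chain-mono (λ j → Ball j u) inj₁ (≤⇒≤′ z≤n) b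
  ball-stable stable (suc m) (inj₁ b) = ball-stable stable m b
  ball-stable stable (suc m) (inj₂ (x , b , e)) =
    stable _ (inj₂ (x , ball-stable stable m b , e))

  connected? : ∀ u w → Dec (u ~ w)
  connected? u w
    with k , stable ← chain-stabilises (λ j → Ball j u) (λ j → ball? j u) inj₁
    = map′ (ball⇒connected k) (λ p → let m , b = connected⇒ball p in ball-stable stable m b)
           (ball? k u w)

  H0-constant : ∀ {f} → IsH0 Γ f → ∀ {u w} → u ~ w → f w ≡ f u
  H0-constant f∈H0 here               = refl
  H0-constant f∈H0 (step {u} {v} e p) = trans (H0-constant f∈H0 p) (f∈H0 u v e)

  componentIndicator : Fin n → Fin n → ℚ
  componentIndicator u w with connected? u w
  ... | yes _ = 1ℚ
  ... | no  _ = 0ℚ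

  componentIndicator-in : ∀ {u w} → u ~ w → componentIndicator u w ≡ 1ℚ
  componentIndicator-in {u} {w} p with connected? u w
  ... | yes _  = refl
  ... | no u≁w = ⊥-elim (u≁w p)

  componentIndicator-out : ∀ {u w} → ¬ u ~ w → componentIndicator u w ≡ 0ℚ
  componentIndicator-out {u} {w} u≁w with connected? u w
  ... | yes p = ⊥-elim (u≁w p)
  ... | no  _ = refl

  componentIndicator-H0 : ∀ u → IsH0 Γ (componentIndicator u)
  componentIndicator-H0 u x y e with connected? u x
  ... | yes p  = componentIndicator-in (connected-snoc p e)
  ... | no u≁x = componentIndicator-out λ q →
                   u≁x (connected-snoc q (trans (SimpleGraph.sym Γ y x) e))

  FixesComponents : Aut Γ → Set
  FixesComponents g = ∀ v → (perm g ⟨$⟩ˡ v) ~ v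

  fixesComponents⇒phi0IsId : (g : Aut Γ) → FixesComponents g → Phi0IsId g
  fixesComponents⇒phi0IsId g fixes f f∈H0 v = sym (H0-constant f∈H0 (fixes v))

  moves⇒¬phi0IsId : (g : Aut Γ) (v : Fin n) → ¬ (perm g ⟨$⟩ˡ v) ~ v → ¬ Phi0IsId g
  moves⇒¬phi0IsId g v moved isId = 1≢0 (begin
    1ℚ                ≡⟨ componentIndicator-in here ⟨
    χ (perm g ⟨$⟩ˡ v) ≡⟨ isId χ (componentIndicator-H0 _) v ⟩
    χ v               ≡⟨ componentIndicator-out moved ⟩
    0ℚ                ∎)
    where
    open ≡-Reasoning
    χ : Fin n → ℚ
    χ = componentIndicator (perm g ⟨$⟩ˡ v)

  ¬phi0IsId⇒moves : (g : Aut Γ) → ¬ Phi0IsId g → ∃ λ v → ¬ (perm g ⟨$⟩ˡ v) ~ v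
  ¬phi0IsId⇒moves g ¬isId with Fin.any? (λ v → ¬? (connected? (perm g ⟨$⟩ˡ v) v))
  ... | yes moved = moved
  ... | no  none  = ⊥-elim (¬isId (fixesComponents⇒phi0IsId g λ v →
                      decidable-stable (connected? _ v) (λ moved → none (v , moved))))

  adj-preserving⇒connected-preserving : (σ : Fin n → Fin n) →
    (∀ x y → adj Γ (σ x) (σ y) ≡ adj Γ x y) → ∀ {u w} → u ~ w → σ u ~ σ w
  adj-preserving⇒connected-preserving σ pres here = here
  adj-preserving⇒connected-preserving σ pres (step {u} {v} e p) =
    step (trans (pres u v) e) (adj-preserving⇒connected-preserving σ pres p)

  preserve⁻¹ : (g : Aut Γ) → ∀ x y → adj Γ (perm g ⟨$⟩ˡ x) (perm g ⟨$⟩ˡ y) ≡ adj Γ x y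
  preserve⁻¹ g x y = begin
    adj Γ (π ⟨$⟩ˡ x) (π ⟨$⟩ˡ y)                     ≡⟨ preserve g (π ⟨$⟩ˡ x) (π ⟨$⟩ˡ y) ⟨
    adj Γ (π ⟨$⟩ʳ (π ⟨$⟩ˡ x)) (π ⟨$⟩ʳ (π ⟨$⟩ˡ y)) ≡⟨ cong₂ (adj Γ) (inverseʳ π) (inverseʳ π) ⟩
    adj Γ x y                                     ∎
    where
    open ≡-Reasoning
    π : Permutation′ n
    π = perm g

  aut-componentIso : (g : Aut Γ) → ∀ v → ComponentIso Γ (perm g ⟨$⟩ˡ v) v
  aut-componentIso g v = record
    { to       = π ⟨$⟩ʳ_
    ; from     = π ⟨$⟩ˡ_
    ; to-mem   = λ w p → subst (λ z → z ~ (π ⟨$⟩ʳ w)) (inverseʳ π)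
                              (adj-preserving⇒connected-preserving (π ⟨$⟩ʳ_) (preserve g) p)
    ; from-mem = λ w → adj-preserving⇒connected-preserving (π ⟨$⟩ˡ_) (preserve⁻¹ g)
    ; from-to  = λ w _ → inverseˡ π
    ; to-from  = λ w _ → inverseʳ π
    ; to-adj   = λ w w′ _ _ → preserve g w w′
    }
    where
    π : Permutation′ n
    π = perm g

  -- Adjacency is false between components, so it suffices to check edges
  -- inside a component, provided σ does not merge components.
  adj-preserving-if-within-components : (σ : Fin n → Fin n) →
    (∀ {w w′} → w ~ w′ → adj Γ (σ w) (σ w′) ≡ adj Γ w w′) →
    (∀ {w w′} → σ w ~ σ w′ → w ~ w′) →
    ∀ w w′ → adj Γ (σ w) (σ w′) ≡ adj Γ w w′
  adj-preserving-if-within-components σ within reflects w w′ with connected? w w′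
  ... | yes p   = within p
  ... | no w≁w′ = trans (adj-false (w≁w′ ∘ reflects)) (sym (adj-false w≁w′))

  module SwapComponents {u v} (u≁v : ¬ u ~ v) (I : ComponentIso Γ u v) where
    open ComponentIso I

    data Side (w : Fin n) : Set where
      inU       : u ~ w → Side w
      inV       : v ~ w → Side w
      elsewhere : ¬ u ~ w → ¬ v ~ w → Side w

    side : ∀ w → Side w
    side w with connected? u w | connected? v w
    ... | yes p | _     = inU p
    ... | no _  | yes q = inV q
    ... | no ¬p | no ¬q = elsewhere ¬p ¬q

    swap : Fin n → Fin n
    swap w with side w
    ... | inU _         = to w
    ... | inV _         = from w
    ... | elsewhere _ _ = w

    not-both : ∀ {w} → u ~ w → v ~ w → ⊥
    not-both p q = u≁v (connected-trans p (connected-sym q))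

    swap-inU : ∀ {w} → u ~ w → swap w ≡ to w
    swap-inU {w} p with side w
    ... | inU _          = refl
    ... | inV q          = ⊥-elim (not-both p q)
    ... | elsewhere ¬p _ = ⊥-elim (¬p p)

    swap-inV : ∀ {w} → v ~ w → swap w ≡ from w
    swap-inV {w} q with side w
    ... | inU p          = ⊥-elim (not-both p q)
    ... | inV _          = refl
    ... | elsewhere _ ¬q = ⊥-elim (¬q q)

    swap-elsewhere : ∀ {w} → ¬ u ~ w → ¬ v ~ w → swap w ≡ w
    swap-elsewhere {w} ¬p ¬q with side w
    ... | inU p         = ⊥-elim (¬p p)
    ... | inV q         = ⊥-elim (¬q q)
    ... | elsewhere _ _ = refl

    data SameSide (w w′ : Fin n) : Set where
      bothU         : u ~ w → u ~ w′ → SameSide w w′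
      bothV         : v ~ w → v ~ w′ → SameSide w w′
      bothElsewhere : ¬ u ~ w → ¬ v ~ w → ¬ u ~ w′ → ¬ v ~ w′ → SameSide w w′

    sameSide : ∀ {w w′} → w ~ w′ → SameSide w w′
    sameSide {w} {w′} p with side w
    ... | inU a           = bothU a (connected-trans a p)
    ... | inV b           = bothV b (connected-trans b p)
    ... | elsewhere ¬a ¬b = bothElsewhere ¬a ¬b (leave ¬a) (leave ¬b)
      where
      leave : ∀ {x} → ¬ x ~ w → ¬ x ~ w′
      leave ¬c c = ¬c (connected-trans c (connected-sym p))

    swap-involutive : ∀ w → swap (swap w) ≡ w
    swap-involutive w with side w
    ... | inU a           = trans (swap-inV (to-mem w a)) (from-to w a)
    ... | inV b           = trans (swap-inU (from-mem w b)) (to-from w b)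
    ... | elsewhere ¬a ¬b = swap-elsewhere ¬a ¬b

    swap-connected : ∀ {w w′} → w ~ w′ → swap w ~ swap w′
    swap-connected {w} {w′} p with sameSide p
    ... | bothU a a′ rewrite swap-inU a | swap-inU a′ =
      connected-trans (connected-sym (to-mem w a)) (to-mem w′ a′)
    ... | bothV b b′ rewrite swap-inV b | swap-inV b′ =
      connected-trans (connected-sym (from-mem w b)) (from-mem w′ b′)
    ... | bothElsewhere ¬a ¬b ¬a′ ¬b′
      rewrite swap-elsewhere ¬a ¬b | swap-elsewhere ¬a′ ¬b′ = p

    swap-reflects-connected : ∀ {w w′} → swap w ~ swap w′ → w ~ w′
    swap-reflects-connected {w} {w′} p =
      subst₂ _~_ (swap-involutive w) (swap-involutive w′) (swap-connected p)

    swap-adj-within : ∀ {w w′} → w ~ w′ → adj Γ (swap w) (swap w′) ≡ adj Γ w w′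
    swap-adj-within {w} {w′} p with sameSide p
    ... | bothU a a′ rewrite swap-inU a | swap-inU a′ = to-adj w w′ a a′
    ... | bothV b b′ rewrite swap-inV b | swap-inV b′ = begin
      adj Γ (from w) (from w′)
        ≡⟨ to-adj (from w) (from w′) (from-mem w b) (from-mem w′ b′) ⟨
      adj Γ (to (from w)) (to (from w′))
        ≡⟨ cong₂ (adj Γ) (to-from w b) (to-from w′ b′) ⟩
      adj Γ w w′
        ∎
      where open ≡-Reasoning
    ... | bothElsewhere ¬a ¬b ¬a′ ¬b′
      rewrite swap-elsewhere ¬a ¬b | swap-elsewhere ¬a′ ¬b′ = refl

    swapAut : Aut Γ
    swapAut = record
      { perm     = permutation swap swap swap-involutive swap-involutive
      ; preserve = adj-preserving-if-within-components swap swap-adj-within swap-reflects-connected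
      }

    swapAut-moves : ¬ (perm swapAut ⟨$⟩ˡ v) ~ v
    swapAut-moves p = u≁v (connected-trans (from-mem v here) (subst (_~ v) (swap-inV here) p))

corollary3p2 : (n : ℕ) (Γ : SimpleGraph n) →
    (TwoIsoComponents Γ → H0GroupNontrivial Γ) × (H0GroupNontrivial Γ → TwoIsoComponents Γ)
corollary3p2 n Γ = twoIso⇒nontrivial , nontrivial⇒twoIso
  where
  twoIso⇒nontrivial : TwoIsoComponents Γ → H0GroupNontrivial Γ
  twoIso⇒nontrivial (u , v , u≁v , I) =
    swapAut , moves⇒¬phi0IsId Γ swapAut v swapAut-moves
    where open SwapComponents Γ u≁v I

  nontrivial⇒twoIso : H0GroupNontrivial Γ → TwoIsoComponents Γ
  nontrivial⇒twoIso (g , ¬isId) with v , moved ← ¬phi0IsId⇒moves Γ g ¬isId =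
    perm g ⟨$⟩ˡ v , v , moved , aut-componentIso Γ g v
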